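{- For every real $\gamma>0$ the following holds for all sufficiently large integers $n$. If $H$ is a $3$-graph on $n$ vertices which is induced $K_4^-$-free and satisfies $\delta_2(H)\ge (1/8+\gamma)n$, then $H$ contains a $Y$-tiling that covers all but at most $40/\gamma+1$ vertices of $H$.
   Context: A $3$-graph $H$ has edge set a family of $3$-element subsets of $V(H)$. $K_4^-$ is the unique (up to isomorphism) $3$-graph with $4$ vertices and $3$ edges; $Y$ is the unique (up to isomorphism) $3$-graph with $4$ vertices and $2$ edges. $H$ is induced $K_4^-$-free if there is no $4$-set $W\subseteq V(H)$ such that exactly $3$ of the $3$-subsets of $W$ are edges of $H$. For distinct vertices $x,y$, $\deg_H(\{x,y\})$ is the number of vertices $z$ with $\{x,y,z\}\in E(H)$, and $\delta_2(H)$ is the minimum of this over all pairs. A $Y$-tiling in $H$ is a collection of vertex-disjoint copies of $Y$ that are subgraphs of $H$; it covers the union of their vertex sets.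
   Formalization: The parameter γ ranges over the positive rationals instead of all positive reals. -}

module Defs where

open import Data.Bool using (Bool; true; false; not; _∧_; if_then_else_)
open import Data.Nat using (ℕ; zero; suc; _+_)
open import Data.Fin using (Fin; _≟_)
open import Data.Fin.Properties using ()
open import Data.List using (List; []; _∷_; map; allFin; concatMap)
open import Data.Nat.ListAction using (sum)
import Data.List.Membership.DecPropositional as DecMem
open import Data.List.Relation.Unary.All using (All)
open import Data.List.Relation.Unary.Unique.Propositional using (Unique)
open import Data.Product using (_×_; _,_)
open import Data.Integer using (+_)
open import Data.Rational using (ℚ; _/_; _÷_; _≤_; Positive)
import Data.Rational as ℚ
open import Data.Rational.Properties using (pos⇒nonZero)
open import Relation.Binary.PropositionalEquality using (_≡_; _≢_)
open import Relation.Nullary.Decidable using (⌊_⌋)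

-- Edges are 3-element subsets; we encode the
-- edge set by its indicator on ordered triples, required to be invariant under
-- all permutations (generated by the two adjacent transpositions).  Only the
-- values on triples of pairwise distinct vertices are ever consulted.
record ThreeGraph (n : ℕ) : Set where
  field
    edge  : Fin n → Fin n → Fin n → Bool
    sym₁₂ : ∀ x y z → edge x y z ≡ edge y x z
    sym₂₃ : ∀ x y z → edge x y z ≡ edge x z y
open ThreeGraph public

_≠ᵇ_ : ∀ {n} → Fin n → Fin n → Bool
x ≠ᵇ y = not ⌊ x ≟ y ⌋

ind : Bool → ℕ
ind true  = 1
ind false = 0

codeg : ∀ {n} → ThreeGraph n → Fin n → Fin n → ℕ
codeg {n} H x y =
  sum (map (λ z → ind ((z ≠ᵇ x) ∧ (z ≠ᵇ y) ∧ edge H x y z)) (allFin n))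

MinCodegAtLeast : ∀ {n} → ThreeGraph n → ℚ → Set
MinCodegAtLeast H c = ∀ x y → x ≢ y → c ≤ (+ codeg H x y / 1)

edges4 : ∀ {n} → ThreeGraph n → Fin n → Fin n → Fin n → Fin n → ℕ
edges4 H a b c d =
  ind (edge H a b c) + ind (edge H a b d) + ind (edge H a c d) + ind (edge H b c d)

InducedK4⁻Free : ∀ {n} → ThreeGraph n → Set
InducedK4⁻Free H = ∀ a b c d → a ≢ b → a ≢ c → a ≢ d → b ≢ c → b ≢ d → c ≢ d →
  edges4 H a b c d ≢ 3

-- A copy of Y (4 vertices, edges {a,b,c} and {a,b,d}) is given by a 4-tuple
-- (a , b , c , d); distinctness of its vertices is enforced by the Unique
-- condition in YTiling below.
Tile : ℕ → Set
Tile n = Fin n × Fin n × Fin n × Fin n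

tileVerts : ∀ {n} → Tile n → List (Fin n)
tileVerts (a , b , c , d) = a ∷ b ∷ c ∷ d ∷ []

IsYCopy : ∀ {n} → ThreeGraph n → Tile n → Set
IsYCopy H (a , b , c , d) = (edge H a b c ≡ true) × (edge H a b d ≡ true)

tilingVerts : ∀ {n} → List (Tile n) → List (Fin n)
tilingVerts = concatMap tileVerts

record YTiling {n : ℕ} (H : ThreeGraph n) : Set where
  field
    tiles    : List (Tile n)
    copies   : All (IsYCopy H) tiles
    disjoint : Unique (tilingVerts tiles)
open YTiling public

uncovered : ∀ {n} {H : ThreeGraph n} → YTiling H → ℕ
uncovered {n} T =
  sum (map (λ v → ind (not ⌊ DecMem._∈?_ _≟_ v (tilingVerts (tiles T)) ⌋)) (allFin n))

bound : (γ : ℚ) → .{{Positive γ}} → ℚ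
bound γ = ((+ 40 / 1) ÷ γ) {{pos⇒nonZero γ}} ℚ.+ (+ 1 / 1)

module Submission where

open import Defs

-- Take a Y-tiling that neither of the two moves below can enlarge, and let U be the set of
-- its u uncovered vertices. First, no two vertices of U have two common neighbours in U, or a
-- new Y fits inside U. Second, fix a covered vertex w and look at its link graph on U: if x₀x
-- is a link edge, induced-K₄⁻-freeness makes every common link-neighbour y of x₀ and x a common
-- neighbour of x₀x in U, so deg x₀ + deg x ≤ u + 1; for x₀ of maximum degree this bounds the
-- degree sum of the link by (2u+1)²/8. If two corners w ≠ w′ of one tile both see vertices of
-- link degree at least 5 (at w two of them), the tile is traded for two Y's x w y z and
-- x′ w′ y′ z′; otherwise the degree sums at the four corners total at most ((2u+1)² + 160u)/8.
-- Double counting the codegrees of pairs in U against the minimum codegree (1/8 + γ)n, with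
-- n = u + 4·#tiles, then forces γ(u − 1) ≤ 40.

module Counting where
  open import Data.Bool using (Bool; true; false; not; _∧_)
  open import Data.Bool.Properties using (∧-conicalˡ; ∧-conicalʳ)
  open import Data.Nat using (ℕ; zero; suc; _+_; _*_; _≤_; _<_; z≤n; s≤s; s≤s⁻¹; _≤?_)
  open import Data.Nat.Properties hiding (_≟_)
  open import Data.Nat.ListAction using (sum)
  open import Data.Fin using (Fin; _≟_) renaming (zero to fzero; suc to fsuc)
  open import Data.Fin.Properties using (any?)
  open import Data.List using (List; []; _∷_; map; allFin; length; _++_; concatMap; tabulate; lookup)
  open import Data.List.Properties using (map-tabulate; tabulate-lookup; length-tabulate)
  open import Data.List.Relation.Unary.All as All using (All; []; _∷_)
  open import Data.List.Relation.Unary.Any using (here; there)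
  open import Data.List.Relation.Unary.AllPairs using ([]; _∷_)
  open import Data.List.Relation.Unary.Unique.Propositional using (Unique)
  open import Data.List.Membership.Propositional using (_∈_)
  open import Data.List.Membership.Propositional.Properties using (∈-lookup)
  import Data.List.Membership.DecPropositional as DecMembership
  open import Data.Product using (Σ; ∃; ∃₂; _×_; _,_)
  open import Relation.Nullary.Decidable using (¬?; _×-dec_)
  open import Data.Sum using (_⊎_; inj₁; inj₂)
  open import Data.Empty using (⊥-elim)
  open import Function using (_∘_)
  open import Relation.Nullary using (yes; no)
  open import Relation.Nullary.Decidable using (⌊_⌋)
  open import Relation.Binary.PropositionalEquality
  open import Data.Nat.Tactic.RingSolver using (solve-∀)

  private
    variable
      A B : Set

  ∑ : List A → (A → ℕ) → ℕ
  ∑ xs f = sum (map f xs)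

  ∑-cong : ∀ (xs : List A) {f g : A → ℕ} → (∀ x → f x ≡ g x) → ∑ xs f ≡ ∑ xs g
  ∑-cong []       f≗g = refl
  ∑-cong (x ∷ xs) f≗g = cong₂ _+_ (f≗g x) (∑-cong xs f≗g)

  ∑-mono-≤ : ∀ (xs : List A) {f g : A → ℕ} → (∀ x → f x ≤ g x) → ∑ xs f ≤ ∑ xs g
  ∑-mono-≤ []       f≤g = z≤n
  ∑-mono-≤ (x ∷ xs) f≤g = +-mono-≤ (f≤g x) (∑-mono-≤ xs f≤g)

  ∑-distrib-+ : ∀ (xs : List A) (f g : A → ℕ) → ∑ xs (λ x → f x + g x) ≡ ∑ xs f + ∑ xs g
  ∑-distrib-+ []       f g = refl
  ∑-distrib-+ (x ∷ xs) f g = trans (cong (f x + g x +_) (∑-distrib-+ xs f g))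
                                   (+-+-comm (f x) (g x) (∑ xs f) (∑ xs g))
    where
    +-+-comm : ∀ a b c d → a + b + (c + d) ≡ a + c + (b + d)
    +-+-comm = solve-∀

  ∑-distribˡ-* : ∀ (xs : List A) k (f : A → ℕ) → ∑ xs (λ x → k * f x) ≡ k * ∑ xs f
  ∑-distribˡ-* []       k f = sym (*-zeroʳ k)
  ∑-distribˡ-* (x ∷ xs) k f =
    trans (cong (k * f x +_) (∑-distribˡ-* xs k f)) (sym (*-distribˡ-+ k (f x) (∑ xs f)))

  ∑-distribʳ-* : ∀ (xs : List A) k (f : A → ℕ) → ∑ xs (λ x → f x * k) ≡ ∑ xs f * k
  ∑-distribʳ-* xs k f =
    trans (∑-cong xs (λ x → *-comm (f x) k)) (trans (∑-distribˡ-* xs k f) (*-comm k (∑ xs f)))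

  ∑-const : ∀ (xs : List A) k → ∑ xs (λ _ → k) ≡ length xs * k
  ∑-const []       k = refl
  ∑-const (x ∷ xs) k = cong (k +_) (∑-const xs k)

  ∑-++ : ∀ (xs ys : List A) (f : A → ℕ) → ∑ (xs ++ ys) f ≡ ∑ xs f + ∑ ys f
  ∑-++ []       ys f = refl
  ∑-++ (x ∷ xs) ys f = trans (cong (f x +_) (∑-++ xs ys f)) (sym (+-assoc (f x) (∑ xs f) (∑ ys f)))

  ∑-concatMap : (h : B → List A) (ys : List B) (f : A → ℕ) →
                ∑ (concatMap h ys) f ≡ ∑ ys (λ y → ∑ (h y) f)
  ∑-concatMap h []       f = refl
  ∑-concatMap h (y ∷ ys) f =
    trans (∑-++ (h y) (concatMap h ys) f) (cong (∑ (h y) f +_) (∑-concatMap h ys f))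

  ∑-comm : (xs : List A) (ys : List B) (f : A → B → ℕ) →
           ∑ xs (λ x → ∑ ys (f x)) ≡ ∑ ys (λ y → ∑ xs (λ x → f x y))
  ∑-comm []       ys f = sym (trans (∑-const ys 0) (*-zeroʳ (length ys)))
  ∑-comm (x ∷ xs) ys f = trans (cong (∑ ys (f x) +_) (∑-comm xs ys f))
                               (sym (∑-distrib-+ ys (f x) (λ y → ∑ xs (λ x′ → f x′ y))))

  ∑-lookup : ∀ (xs : List A) (f : A → ℕ) → ∑ (allFin (length xs)) (f ∘ lookup xs) ≡ ∑ xs f
  ∑-lookup xs f = cong sum (begin
    map (f ∘ lookup xs) (tabulate (λ i → i)) ≡⟨ map-tabulate (λ i → i) (f ∘ lookup xs) ⟩
    tabulate (f ∘ lookup xs)                  ≡⟨ sym (map-tabulate (lookup xs) f) ⟩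
    map f (tabulate (lookup xs))              ≡⟨ cong (map f) (tabulate-lookup xs) ⟩
    map f xs                                  ∎)
    where open ≡-Reasoning

  *-∑-≤ : ∀ (xs : List A) (f : A → ℕ) c K → All (λ x → c * f x ≤ K) xs → c * ∑ xs f ≤ length xs * K
  *-∑-≤ []       f c K []         = ≤-reflexive (*-zeroʳ c)
  *-∑-≤ (x ∷ xs) f c K (px ∷ pxs) =
    ≤-trans (≤-reflexive (*-distribˡ-+ c (f x) (∑ xs f))) (+-mono-≤ px (*-∑-≤ xs f c K pxs))

  lookup-injective : ∀ {xs : List A} → Unique xs → ∀ {i j} → lookup xs i ≡ lookup xs j → i ≡ j
  lookup-injective (x∉xs ∷ u) {fzero}  {fzero}  _ = refl
  lookup-injective (x∉xs ∷ u) {fzero}  {fsuc j} x≡xⱼ = ⊥-elim (All.lookup x∉xs (∈-lookup j) x≡xⱼ)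
  lookup-injective (x∉xs ∷ u) {fsuc i} {fzero}  xᵢ≡x = ⊥-elim (All.lookup x∉xs (∈-lookup i) (sym xᵢ≡x))
  lookup-injective (x∉xs ∷ u) {fsuc i} {fsuc j} xᵢ≡xⱼ = cong fsuc (lookup-injective u xᵢ≡xⱼ)

  some-or-All : ∀ {C : Set} {P : A → Set} (xs : List A) → (∀ {x} → x ∈ xs → C ⊎ P x) → C ⊎ All P xs
  some-or-All []       _     = inj₂ []
  some-or-All (x ∷ xs) decide with decide (here refl) | some-or-All xs (decide ∘ there)
  ... | inj₁ c  | _         = inj₁ c
  ... | inj₂ _  | inj₁ c    = inj₁ c
  ... | inj₂ px | inj₂ pxs  = inj₂ (px ∷ pxs)

  ind≤1 : ∀ b → ind b ≤ 1
  ind≤1 true  = ≤-refl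
  ind≤1 false = z≤n

  ind-∧-≤ˡ : ∀ a b → ind (a ∧ b) ≤ ind a
  ind-∧-≤ˡ true  b = ind≤1 b
  ind-∧-≤ˡ false b = z≤n

  ind-∧-≤ʳ : ∀ a b → ind (a ∧ b) ≤ ind b
  ind-∧-≤ʳ true  b = ≤-refl
  ind-∧-≤ʳ false b = z≤n

  ind-split : ∀ a c → ind a ≡ ind (a ∧ c) + ind (a ∧ not c)
  ind-split true  true  = refl
  ind-split true  false = refl
  ind-split false c     = refl

  ind-not : ∀ a → ind a + ind (not a) ≡ 1
  ind-not true  = refl
  ind-not false = refl

  ind-true-* : ∀ {b} {k} → b ≡ true → ind b * k ≡ k
  ind-true-* refl = +-identityʳ _

  ind-false-* : ∀ {b} {k} → b ≡ false → ind b * k ≡ 0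
  ind-false-* refl = refl

  module _ {n : ℕ} where

    count : (Fin n → Bool) → ℕ
    count p = ∑ (allFin n) (λ x → ind (p x))

    _≡ᵇ_ : Fin n → Fin n → Bool
    x ≡ᵇ y = ⌊ x ≟ y ⌋

    ≠ᵇ⇒≢ : ∀ {x y : Fin n} → (x ≠ᵇ y) ≡ true → x ≢ y
    ≠ᵇ⇒≢ {x} {y} x≠y with x ≟ y
    ... | no x≢y = x≢y

  ∑-allFin-suc : ∀ {n} (f : Fin (suc n) → ℕ) → ∑ (allFin (suc n)) f ≡ f fzero + ∑ (allFin n) (f ∘ fsuc)
  ∑-allFin-suc {n} f = begin
    ∑ (allFin (suc n)) f           ≡⟨ cong sum (map-tabulate (λ i → i) f) ⟩
    f fzero + sum (tabulate (f ∘ fsuc)) ≡⟨ cong (f fzero +_) (sym (cong sum (map-tabulate (λ i → i) (f ∘ fsuc)))) ⟩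
    f fzero + ∑ (allFin n) (f ∘ fsuc)    ∎
    where open ≡-Reasoning

  count-≡ᵇ : ∀ {n} (x : Fin n) → count (_≡ᵇ x) ≡ 1
  count-≡ᵇ {suc n} fzero = trans (∑-allFin-suc {n} (λ v → ind (v ≡ᵇ fzero)))
                                 (cong suc (trans (∑-cong (allFin n) (λ _ → refl))
                                                 (trans (∑-const (allFin n) 0) (*-zeroʳ (length (allFin n))))))
  count-≡ᵇ {suc n} (fsuc x) = trans (∑-allFin-suc {n} (λ v → ind (v ≡ᵇ fsuc x)))
                                    (trans (∑-cong (allFin n) (λ v → cong ind (suc-≡ᵇ v))) (count-≡ᵇ x))
    where
    suc-≡ᵇ : ∀ v → (fsuc v ≡ᵇ fsuc x) ≡ (v ≡ᵇ x)
    suc-≡ᵇ v with v ≟ x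
    ... | yes _ = refl
    ... | no _  = refl

  ∑-δ : ∀ {n} (x : Fin n) (g : Fin n → ℕ) → ∑ (allFin n) (λ v → ind (v ≡ᵇ x) * g v) ≡ g x
  ∑-δ {n} x g = begin
    ∑ (allFin n) (λ v → ind (v ≡ᵇ x) * g v) ≡⟨ ∑-cong (allFin n) δ-g ⟩
    ∑ (allFin n) (λ v → ind (v ≡ᵇ x) * g x) ≡⟨ ∑-distribʳ-* (allFin n) (g x) (λ v → ind (v ≡ᵇ x)) ⟩
    count (_≡ᵇ x) * g x                      ≡⟨ cong (_* g x) (count-≡ᵇ x) ⟩
    1 * g x                                  ≡⟨ *-identityˡ (g x) ⟩
    g x                                      ∎
    where
    open ≡-Reasoning
    δ-g : ∀ v → ind (v ≡ᵇ x) * g v ≡ ind (v ≡ᵇ x) * g x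
    δ-g v with v ≟ x
    ... | yes refl = refl
    ... | no _     = refl

  count-≤-∧≠ᵇ : ∀ {n} (p : Fin n → Bool) (s : Fin n) → count p ≤ suc (count (λ y → p y ∧ (y ≠ᵇ s)))
  count-≤-∧≠ᵇ {n} p s = begin
    count p                                                    ≤⟨ ∑-mono-≤ (allFin n) split ⟩
    ∑ (allFin n) (λ y → ind (p y ∧ (y ≠ᵇ s)) + ind (y ≡ᵇ s))  ≡⟨ ∑-distrib-+ (allFin n) _ _ ⟩
    count (λ y → p y ∧ (y ≠ᵇ s)) + count (_≡ᵇ s)              ≡⟨ cong (count (λ y → p y ∧ (y ≠ᵇ s)) +_) (count-≡ᵇ s) ⟩
    count (λ y → p y ∧ (y ≠ᵇ s)) + 1                          ≡⟨ +-comm _ 1 ⟩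
    suc (count (λ y → p y ∧ (y ≠ᵇ s)))                        ∎
    where
    open ≤-Reasoning
    split : ∀ y → ind (p y) ≤ ind (p y ∧ (y ≠ᵇ s)) + ind (y ≡ᵇ s)
    split y with p y | y ≟ s
    ... | false | _     = z≤n
    ... | true  | yes _ = ≤-refl
    ... | true  | no _  = ≤-refl

  count-witness : ∀ {n} (p : Fin n → Bool) → 1 ≤ count p → ∃ λ x → p x ≡ true
  count-witness {n} p = go (allFin n)
    where
    go : ∀ xs → 1 ≤ ∑ xs (λ x → ind (p x)) → ∃ λ x → p x ≡ true
    go (x ∷ xs) h with p x in px
    ... | true  = x , px
    ... | false = go xs h

  count-witness-∉ : ∀ {n} (p : Fin n → Bool) (S : List (Fin n)) → suc (length S) ≤ count p →
                    ∃ λ y → p y ≡ true × All (y ≢_) S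
  count-witness-∉ p []      h = let y , py = count-witness p h in y , py , []
  count-witness-∉ p (s ∷ S) h
    with y , py∧y≠s , y∉S ← count-witness-∉ (λ y → p y ∧ (y ≠ᵇ s)) S
                              (s≤s⁻¹ (≤-trans h (count-≤-∧≠ᵇ p s)))
    = y , ∧-conicalˡ _ _ py∧y≠s , ≠ᵇ⇒≢ (∧-conicalʳ _ _ py∧y≠s) ∷ y∉S

  mult : ∀ {n} → Fin n → List (Fin n) → ℕ
  mult v xs = ∑ xs (λ x → ind (v ≡ᵇ x))

  module _ {n : ℕ} where
    open DecMembership (_≟_ {n}) using (_∈?_)

    mult≡0⇒∉ : ∀ (v : Fin n) xs → mult v xs ≡ 0 → All (v ≢_) xs
    mult≡0⇒∉ v []       _ = []
    mult≡0⇒∉ v (x ∷ xs) m≡0 with v ≟ x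
    ... | no v≢x = v≢x ∷ mult≡0⇒∉ v xs m≡0

    ∉⇒mult≡0 : ∀ (v : Fin n) xs → All (v ≢_) xs → mult v xs ≡ 0
    ∉⇒mult≡0 v []       []           = refl
    ∉⇒mult≡0 v (x ∷ xs) (v≢x ∷ v∉xs) with v ≟ x
    ... | yes v≡x = ⊥-elim (v≢x v≡x)
    ... | no _    = ∉⇒mult≡0 v xs v∉xs

    Unique⇒mult≤1 : ∀ {xs : List (Fin n)} → Unique xs → ∀ v → mult v xs ≤ 1
    Unique⇒mult≤1 [] v = z≤n
    Unique⇒mult≤1 {x ∷ xs} (x∉xs ∷ u) v with v ≟ x
    ... | yes refl = ≤-reflexive (cong suc (∉⇒mult≡0 x xs x∉xs))
    ... | no _     = Unique⇒mult≤1 u v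

    mult≤1⇒Unique : ∀ (xs : List (Fin n)) → (∀ v → mult v xs ≤ 1) → Unique xs
    mult≤1⇒Unique []       _  = []
    mult≤1⇒Unique (x ∷ xs) m≤1 =
      mult≡0⇒∉ x xs (n≤0⇒n≡0 (s≤s⁻¹ (subst (λ b → ind b + mult x xs ≤ 1) (≡ᵇ-refl x) (m≤1 x))))
      ∷ mult≤1⇒Unique xs (λ v → ≤-trans (m≤n+m (mult v xs) (ind (v ≡ᵇ x))) (m≤1 v))
      where
      ≡ᵇ-refl : ∀ x → (x ≡ᵇ x) ≡ true
      ≡ᵇ-refl x with x ≟ x
      ... | yes _   = refl
      ... | no x≢x = ⊥-elim (x≢x refl)

    ∈⇒1≤mult : ∀ {v : Fin n} {xs} → v ∈ xs → 1 ≤ mult v xs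
    ∈⇒1≤mult {v} {x ∷ xs} (here v≡x) with v ≟ x
    ... | yes _   = s≤s z≤n
    ... | no v≢x = ⊥-elim (v≢x v≡x)
    ∈⇒1≤mult {v} {x ∷ xs} (there v∈xs) = ≤-trans (∈⇒1≤mult v∈xs) (m≤n+m _ (ind (v ≡ᵇ x)))

    1≤mult⇒∈ : ∀ {v : Fin n} xs → 1 ≤ mult v xs → v ∈ xs
    1≤mult⇒∈ {v} (x ∷ xs) h with v ≟ x
    ... | yes v≡x = here v≡x
    ... | no _    = there (1≤mult⇒∈ xs h)

    ind-∈?≡mult : ∀ {xs : List (Fin n)} → Unique xs → ∀ v → ind ⌊ v ∈? xs ⌋ ≡ mult v xs
    ind-∈?≡mult {xs} u v with v ∈? xs
    ... | yes v∈xs = ≤-antisym (∈⇒1≤mult v∈xs) (Unique⇒mult≤1 u v)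
    ... | no v∉xs with mult v xs in m≡
    ...   | zero  = refl
    ...   | suc _ = ⊥-elim (v∉xs (1≤mult⇒∈ xs (≤-trans (s≤s z≤n) (≤-reflexive (sym m≡)))))

    ∑-∈? : ∀ {xs : List (Fin n)} → Unique xs → ∀ f →
           ∑ (allFin n) (λ v → ind ⌊ v ∈? xs ⌋ * f v) ≡ ∑ xs f
    ∑-∈? {xs} u f = begin
      ∑ (allFin n) (λ v → ind ⌊ v ∈? xs ⌋ * f v)              ≡⟨ ∑-cong (allFin n) (λ v → cong (_* f v) (ind-∈?≡mult u v)) ⟩
      ∑ (allFin n) (λ v → mult v xs * f v)                    ≡⟨ ∑-cong (allFin n) (λ v → sym (∑-distribʳ-* xs (f v) _)) ⟩
      ∑ (allFin n) (λ v → ∑ xs (λ x → ind (v ≡ᵇ x) * f v))    ≡⟨ ∑-comm (allFin n) xs _ ⟩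
      ∑ xs (λ x → ∑ (allFin n) (λ v → ind (v ≡ᵇ x) * f v))    ≡⟨ ∑-cong xs (λ x → ∑-δ x f) ⟩
      ∑ xs f                                                   ∎
      where open ≡-Reasoning

  module _ {m} (g h : Fin m → ℕ) (Q U : ℕ) (8g≤Q : ∀ i → 8 * g i ≤ Q) (g≤ : ∀ i → g i ≤ 4 * U + h i * U) where
    open ≤-Reasoning

    private
      8g≤40U : ∀ j → h j ≤ 1 → 8 * g j ≤ 40 * U
      8g≤40U j hⱼ≤1 = begin
        8 * g j               ≤⟨ *-monoʳ-≤ 8 (g≤ j) ⟩
        8 * (4 * U + h j * U) ≤⟨ *-monoʳ-≤ 8 (+-monoʳ-≤ (4 * U) (*-monoˡ-≤ U hⱼ≤1)) ⟩
        8 * (4 * U + 1 * U)   ≡⟨ eight-five U ⟩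
        40 * U                ∎
        where
        eight-five : ∀ U → 8 * (4 * U + 1 * U) ≡ 40 * U
        eight-five = solve-∀

      ∑-40U : ∑ (allFin m) (λ _ → 40 * U) ≡ 40 * m * U
      ∑-40U = trans (∑-const (allFin m) (40 * U))
                    (trans (cong (_* (40 * U)) (length-tabulate {n = m} (λ i → i))) (reorder m U))
        where
        reorder : ∀ m U → m * (40 * U) ≡ 40 * m * U
        reorder = solve-∀

      bounded-by : ∀ (B : Fin m → ℕ) → (∀ j → 8 * g j ≤ B j) → ∑ (allFin m) B ≤ Q + 40 * m * U →
                   8 * ∑ (allFin m) g ≤ Q + 40 * m * U
      bounded-by B 8g≤B ∑B≤ = begin
        8 * ∑ (allFin m) g            ≡⟨ sym (∑-distribˡ-* (allFin m) 8 g) ⟩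
        ∑ (allFin m) (λ j → 8 * g j) ≤⟨ ∑-mono-≤ (allFin m) 8g≤B ⟩
        ∑ (allFin m) B               ≤⟨ ∑B≤ ⟩
        Q + 40 * m * U                ∎

    two-rich-or-∑-bounded : (∃₂ λ i j → i ≢ j × 2 ≤ h i × 1 ≤ h j) ⊎ 8 * ∑ (allFin m) g ≤ Q + 40 * m * U
    two-rich-or-∑-bounded with any? (λ i → 2 ≤? h i)
    ... | yes (i , 2≤hᵢ) with any? (λ j → ¬? (j ≟ i) ×-dec (1 ≤? h j))
    ...   | yes (j , j≢i , 1≤hⱼ) = inj₁ (i , j , ≢-sym j≢i , 2≤hᵢ , 1≤hⱼ)
    ...   | no no-j = inj₂ (bounded-by (λ j → ind (j ≡ᵇ i) * Q + 40 * U) only-i (≤-reflexive (begin-equality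
            ∑ (allFin m) (λ j → ind (j ≡ᵇ i) * Q + 40 * U)  ≡⟨ ∑-distrib-+ (allFin m) _ _ ⟩
            ∑ (allFin m) (λ j → ind (j ≡ᵇ i) * Q) + ∑ (allFin m) (λ _ → 40 * U)
                ≡⟨ cong₂ _+_ (trans (∑-distribʳ-* (allFin m) Q (λ j → ind (j ≡ᵇ i)))
                                    (trans (cong (_* Q) (count-≡ᵇ i)) (*-identityˡ Q)))
                             ∑-40U ⟩
            Q + 40 * m * U ∎)))
      where
      only-i : ∀ j → 8 * g j ≤ ind (j ≡ᵇ i) * Q + 40 * U
      only-i j with j ≟ i
      ... | yes refl = ≤-trans (8g≤Q j) (≤-trans (≤-reflexive (sym (+-identityʳ Q))) (m≤m+n _ _))
      ... | no j≢i   = 8g≤40U j (≤-trans (≮⇒≥ (λ 1≤hⱼ → no-j (j , j≢i , 1≤hⱼ))) z≤n)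
    two-rich-or-∑-bounded | no no-i =
      inj₂ (bounded-by (λ _ → 40 * U) (λ j → 8g≤40U j (≤-pred (≰⇒> (λ 2≤hⱼ → no-i (j , 2≤hⱼ)))))
                       (≤-trans (≤-reflexive ∑-40U) (m≤n+m _ Q)))

  module _ {X : Set} {Stuck : X → Set} (size : X → ℕ) (N : ℕ) (size≤N : ∀ x → size x ≤ N)
           (step : ∀ x → (Σ X λ y → size x < size y) ⊎ Stuck x) where

    reach-stuck : X → Σ X Stuck
    reach-stuck x = go N x (m≤m+n N (size x))
      where
      go : ∀ fuel x → N ≤ fuel + size x → Σ X Stuck
      go fuel x N≤ with step x
      ... | inj₂ stuck = x , stuck
      go zero       x N≤ | inj₁ (y , x<y) = ⊥-elim (<⇒≱ x<y (≤-trans (size≤N y) N≤))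
      go (suc fuel) x N≤ | inj₁ (y , x<y) =
        go fuel y (≤-trans N≤ (≤-trans (≤-reflexive (sym (+-suc fuel (size x)))) (+-monoʳ-≤ fuel x<y)))

module Arithmetic where
  open import Data.Nat using (zero; suc; _+_; _*_; _≤_; _<_; z≤n; s≤s; _≤?_; NonZero; >-nonZero)
  open import Data.Nat.Properties
  open import Data.Product using (_,_)
  open import Data.Empty using (⊥-elim)
  open import Relation.Nullary using (yes; no)
  open import Relation.Binary.PropositionalEquality
  open import Data.Nat.Tactic.RingSolver using (solve-∀)

  8m[2r+1]≤[2[m+r]+1]² : ∀ m r → 8 * (m * (2 * r + 1)) ≤ (2 * (m + r) + 1) * (2 * (m + r) + 1)
  8m[2r+1]≤[2[m+r]+1]² m r with m ≤? r
  ... | yes m≤r with k , refl ← m≤n⇒∃[o]m+o≡n m≤r =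
    ≤-trans (m≤m+n _ _) (≤-reflexive (sym (m≤r-gap m k)))
    where
    m≤r-gap : ∀ m k → (2 * (m + (m + k)) + 1) * (2 * (m + (m + k)) + 1)
                       ≡ 8 * (m * (2 * (m + k) + 1)) + (2 * k + 1) * (2 * k + 1)
    m≤r-gap = solve-∀
  ... | no m≰r with k , refl ← m≤n⇒∃[o]m+o≡n (≰⇒> m≰r) =
    ≤-trans (m≤m+n _ _) (≤-reflexive (sym (r<m-gap r k)))
    where
    r<m-gap : ∀ r k → (2 * (suc r + k + r) + 1) * (2 * (suc r + k + r) + 1)
                       ≡ 8 * ((suc r + k) * (2 * r + 1)) + (2 * k + 1) * (2 * k + 1)
    r<m-gap = solve-∀

  quadratic⇒linear : ∀ a b u P → P + u ≡ u * u → 16 * a * P ≤ b * (168 * u + 1) → a * u ≤ 40 * b + a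
  quadratic⇒linear a b zero    P _ _ = ≤-trans (≤-reflexive (*-zeroʳ a)) z≤n
  quadratic⇒linear a b (suc v) P P+u≡u² 16aP≤ with a * suc v ≤? 40 * b + a
  ... | yes au≤ = au≤
  ... | no au≰ = ⊥-elim (<⇒≱ 16aP> 16aP≤)
    where
    P≡ : P ≡ v * suc v
    P≡ = +-cancelʳ-≡ (suc v) P (v * suc v) (trans P+u≡u² (u²≡ v))
      where
      u²≡ : ∀ v → suc v * suc v ≡ v * suc v + suc v
      u²≡ = solve-∀
    40b<av : 40 * b + 1 ≤ a * v
    40b<av = +-cancelˡ-≤ a _ _ (subst₂ _≤_ (lhs≡ a b) (rhs≡ a v) (≰⇒> au≰))
      where
      lhs≡ : ∀ a b → suc (40 * b + a) ≡ a + (40 * b + 1)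
      lhs≡ = solve-∀
      rhs≡ : ∀ a v → a * suc v ≡ a + a * v
      rhs≡ = solve-∀
    16aP> : b * (168 * suc v + 1) < 16 * a * P
    16aP> = begin-strict
      b * (168 * suc v + 1)                              <⟨ m<m+n _ (s≤s z≤n) ⟩
      b * (168 * suc v + 1) + suc (471 * b + 472 * b * v + 16 * v + 15) ≡⟨ gap b v ⟩
      16 * (40 * b + 1) * suc v                          ≤⟨ *-monoˡ-≤ (suc v) (*-monoʳ-≤ 16 40b<av) ⟩
      16 * (a * v) * suc v                               ≡⟨ reassoc a v ⟩
      16 * a * (v * suc v)                               ≡⟨ cong (16 * a *_) (sym P≡) ⟩
      16 * a * P                                         ∎
      where
      open ≤-Reasoning
      gap : ∀ b v → b * (168 * suc v + 1) + suc (471 * b + 472 * b * v + 16 * v + 15) ≡ 16 * (40 * b + 1) * suc v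
      gap = solve-∀
      reassoc : ∀ a v → 16 * (a * v) * suc v ≡ 16 * a * (v * suc v)
      reassoc = solve-∀

  4bnP+16anP≤bnK : ∀ a b n t P C S K → 1 ≤ a → 2 * b ≤ n → 4 * t ≤ n →
                   P * ((b + 8 * a) * n) ≤ C * (8 * b) → C ≤ P + S → 8 * S ≤ t * K →
                   4 * b * n * P + 16 * a * n * P ≤ b * n * K
  4bnP+16anP≤bnK a b n t P C S K 1≤a 2b≤n 4t≤n degree C≤P+S 8S≤tK =
    +-cancelʳ-≤ (16 * a * n * P) _ _ (begin
      4 * b * n * P + 16 * a * n * P + 16 * a * n * P ≡⟨ times-4 a b n P ⟩
      4 * (P * ((b + 8 * a) * n))       ≤⟨ *-monoʳ-≤ 4 degree ⟩
      4 * (C * (8 * b))                 ≤⟨ *-monoʳ-≤ 4 (*-monoˡ-≤ (8 * b) C≤P+S) ⟩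
      4 * ((P + S) * (8 * b))           ≡⟨ split-S b P S ⟩
      32 * b * P + 4 * b * (8 * S)      ≤⟨ +-monoʳ-≤ (32 * b * P) (*-monoʳ-≤ (4 * b) 8S≤tK) ⟩
      32 * b * P + 4 * b * (t * K)      ≡⟨ cong (32 * b * P +_) (regroup b t K) ⟩
      32 * b * P + b * (4 * t) * K      ≤⟨ +-mono-≤ 32bP≤16anP (*-monoˡ-≤ K (*-monoʳ-≤ b 4t≤n)) ⟩
      16 * a * n * P + b * n * K        ≡⟨ +-comm _ (b * n * K) ⟩
      b * n * K + 16 * a * n * P        ∎)
    where
    open ≤-Reasoning
    32bP≤16anP : 32 * b * P ≤ 16 * a * n * P
    32bP≤16anP = begin
      32 * b * P       ≡⟨ cong (_* P) (*-assoc 16 2 b) ⟩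
      16 * (2 * b) * P ≤⟨ *-monoˡ-≤ P (*-monoʳ-≤ 16 (≤-trans 2b≤n (≤-reflexive (sym (*-identityˡ n))))) ⟩
      16 * (1 * n) * P ≤⟨ *-monoˡ-≤ P (*-monoʳ-≤ 16 (*-monoˡ-≤ n 1≤a)) ⟩
      16 * (a * n) * P ≡⟨ cong (_* P) (sym (*-assoc 16 a n)) ⟩
      16 * a * n * P   ∎
    times-4 : ∀ a b n P → 4 * b * n * P + 16 * a * n * P + 16 * a * n * P ≡ 4 * (P * ((b + 8 * a) * n))
    times-4 = solve-∀
    split-S : ∀ b P S → 4 * ((P + S) * (8 * b)) ≡ 32 * b * P + 4 * b * (8 * S)
    split-S = solve-∀
    regroup : ∀ b t K → 4 * b * (t * K) ≡ b * (4 * t) * K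
    regroup = solve-∀

  codegreeCount⇒quadratic : ∀ a b n u t P C S → 1 ≤ a → 1 ≤ b → 2 * b ≤ n →
    u + 4 * t ≡ n → P + u ≡ u * u →
    P * ((b + 8 * a) * n) ≤ C * (8 * b) → C ≤ P + S →
    8 * S ≤ t * ((2 * u + 1) * (2 * u + 1) + 160 * u) →
    16 * a * P ≤ b * (168 * u + 1)
  codegreeCount⇒quadratic a b n u t P C S 1≤a 1≤b 2b≤n u+4t≡n P+u≡u² degree C≤P+S 8S≤tK =
    *-cancelˡ-≤ n {{n≢0}} (+-cancelʳ-≤ (4 * b * n * (u * u)) _ _ (begin
      n * (16 * a * P) + 4 * b * n * (u * u)           ≡⟨ cong (λ x → n * (16 * a * P) + 4 * b * n * x) (sym P+u≡u²) ⟩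
      n * (16 * a * P) + 4 * b * n * (P + u)           ≡⟨ expand-P a b n P u ⟩
      (4 * b * n * P + 16 * a * n * P) + 4 * b * n * u ≤⟨ +-monoˡ-≤ (4 * b * n * u) pair-count ⟩
      b * n * K + 4 * b * n * u                        ≡⟨ expand-K b n u ⟩
      n * (b * (168 * u + 1)) + 4 * b * n * (u * u)    ∎))
    where
    open ≤-Reasoning
    K = (2 * u + 1) * (2 * u + 1) + 160 * u
    n≢0 : NonZero n
    n≢0 = >-nonZero (≤-trans (s≤s z≤n) (≤-trans (*-monoʳ-≤ 2 1≤b) 2b≤n))
    pair-count : 4 * b * n * P + 16 * a * n * P ≤ b * n * K
    pair-count = 4bnP+16anP≤bnK a b n t P C S K 1≤a 2b≤n (subst (4 * t ≤_) u+4t≡n (m≤n+m (4 * t) u)) degree C≤P+S 8S≤tK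
    expand-P : ∀ a b n P u → n * (16 * a * P) + 4 * b * n * (P + u) ≡ (4 * b * n * P + 16 * a * n * P) + 4 * b * n * u
    expand-P = solve-∀
    expand-K : ∀ b n u → b * n * ((2 * u + 1) * (2 * u + 1) + 160 * u) + 4 * b * n * u
                         ≡ n * (b * (168 * u + 1)) + 4 * b * n * (u * u)
    expand-K = solve-∀

module Tiling where
  open import Data.Bool using (Bool; true; false; not; _∧_)
  import Data.Bool as Bool
  open import Data.Bool.Properties using (∧-conicalˡ; ∧-conicalʳ)
  open import Data.Nat using (ℕ; suc; _+_; _*_; _≤_; _<_; z≤n; s≤s; _≤?_)
  open import Data.Nat.Properties hiding (_≟_)
  open import Data.Fin using (Fin; _≟_)
  open import Data.List using (List; []; _∷_; allFin; length; _++_; lookup)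
  open import Data.List.Properties using (length-++-sucʳ; ++-assoc; length-tabulate)
  open import Data.List.Relation.Unary.All as All using (All; []; _∷_)
  open import Data.List.Relation.Unary.All.Properties using (++⁻; ++⁺)
  open import Data.List.Relation.Unary.AllPairs using ([]; _∷_)
  open import Data.List.Relation.Unary.Unique.Propositional using (Unique)
  import Data.List.Relation.Unary.Unique.Propositional.Properties as Unique
  open import Data.List.Membership.Propositional using (_∈_; _∉_)
  open import Data.List.Membership.Propositional.Properties using (∈-tabulate⁺; ∈-lookup; ∈-∃++)
  import Data.List.Membership.DecPropositional as DecMembership
  open import Data.List.Extrema.Nat using (argmax; f[xs]≤f[argmax])
  open import Data.Product using (Σ; ∃₂; _×_; _,_; proj₁; proj₂)
  open import Data.Sum using (_⊎_; inj₁; inj₂)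
  open import Data.Empty using (⊥-elim)
  open import Function using (_∘_; case_of_)
  open import Relation.Nullary using (¬_; Dec; yes; no)
  open import Relation.Nullary.Decidable using (⌊_⌋; ¬?; _×-dec_)
  open import Data.Fin.Properties using (any?)
  open import Relation.Binary.PropositionalEquality
  open import Data.Nat.Tactic.RingSolver using (solve-∀)
  open Counting
  open Arithmetic

  fourth-edge : ∀ {n} (H : ThreeGraph n) → InducedK4⁻Free H → ∀ {a b c d} →
                a ≢ b → a ≢ c → a ≢ d → b ≢ c → b ≢ d → c ≢ d →
                edge H a b d ≡ true → edge H a c d ≡ true → edge H b c d ≡ true → edge H a b c ≡ true
  fourth-edge H K4⁻-free {a} {b} {c} {d} a≢b a≢c a≢d b≢c b≢d c≢d abd acd bcd with edge H a b c in abc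
  ... | true  = refl
  ... | false = ⊥-elim (K4⁻-free a b c d a≢b a≢c a≢d b≢c b≢d c≢d (three-edges abc abd acd bcd))
    where
    three-edges : ∀ {x y z w} → x ≡ false → y ≡ true → z ≡ true → w ≡ true → ind x + ind y + ind z + ind w ≡ 3
    three-edges refl refl refl refl = refl

  module Uncovered {n} (H : ThreeGraph n) (ts : List (Tile n)) where
    open DecMembership (_≟_ {n}) using (_∈?_)

    vs : List (Fin n)
    vs = tilingVerts ts

    covered free : Fin n → Bool
    covered v = ⌊ v ∈? vs ⌋
    free v = not (covered v)

    #free : ℕ
    #free = count free

    freeCodeg : Fin n → Fin n → ℕ
    freeCodeg x y = count (λ z → free z ∧ (z ≠ᵇ x) ∧ (z ≠ᵇ y) ∧ edge H x y z)

    NoFreeY : Set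
    NoFreeY = ∀ {x y} → free x ≡ true → free y ≡ true → x ≢ y → freeCodeg x y ≤ 1

    link : Fin n → Fin n → Fin n → Bool
    link w x y = free y ∧ (y ≠ᵇ x) ∧ edge H x y w

    linkDeg : Fin n → Fin n → ℕ
    linkDeg w x = count (link w x)

    linkSum : Fin n → ℕ
    linkSum w = ∑ (allFin n) (λ x → ind (free x) * linkDeg w x)

    rich : Fin n → Fin n → Bool
    rich w x = free x ∧ ⌊ 5 ≤? linkDeg w x ⌋

    free≢covered : ∀ {p q} → free p ≡ true → covered q ≡ true → p ≢ q
    free≢covered fp cq refl with () ← trans (sym fp) (cong not cq)

    free-neighbour : ∀ {t x b} → (free t ∧ (t ≠ᵇ x) ∧ b) ≡ true → free t ≡ true × t ≢ x × b ≡ true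
    free-neighbour {t} {x} {b} e = ∧-conicalˡ (free t) _ e , ≠ᵇ⇒≢ (∧-conicalˡ (t ≠ᵇ x) b t≠x∧b) , ∧-conicalʳ (t ≠ᵇ x) b t≠x∧b
      where
      t≠x∧b : ((t ≠ᵇ x) ∧ b) ≡ true
      t≠x∧b = ∧-conicalʳ (free t) _ e

    free-common-neighbour : ∀ {z x y b} → (free z ∧ (z ≠ᵇ x) ∧ (z ≠ᵇ y) ∧ b) ≡ true →
                            free z ≡ true × z ≢ x × z ≢ y × b ≡ true
    free-common-neighbour e with fz , z≢x , z≠y∧b ← free-neighbour e =
      fz , z≢x , ≠ᵇ⇒≢ (∧-conicalˡ _ _ z≠y∧b) , ∧-conicalʳ _ _ z≠y∧b

    linkDeg-adjacent : InducedK4⁻Free H → NoFreeY → ∀ {w x₀ x} → covered w ≡ true → free x₀ ≡ true →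
                       free x ≡ true → x ≢ x₀ → edge H x₀ x w ≡ true → linkDeg w x₀ + linkDeg w x ≤ #free + 1
    linkDeg-adjacent K4⁻-free noY {w} {x₀} {x} cw fx₀ fx x≢x₀ x₀xw = begin
      linkDeg w x₀ + linkDeg w x                            ≡⟨ sym (∑-distrib-+ (allFin n) _ _) ⟩
      ∑ (allFin n) (λ y → ind (link w x₀ y) + ind (link w x y)) ≤⟨ ∑-mono-≤ (allFin n) common ⟩
      ∑ (allFin n) (λ y → ind (free y) + ind (free y ∧ (y ≠ᵇ x₀) ∧ (y ≠ᵇ x) ∧ edge H x₀ x y))
                                                            ≡⟨ ∑-distrib-+ (allFin n) _ _ ⟩
      #free + freeCodeg x₀ x                                ≤⟨ +-monoʳ-≤ #free (noY fx₀ fx (≢-sym x≢x₀)) ⟩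
      #free + 1                                             ∎
      where
      open ≤-Reasoning
      common : ∀ y → ind (link w x₀ y) + ind (link w x y)
                     ≤ ind (free y) + ind (free y ∧ (y ≠ᵇ x₀) ∧ (y ≠ᵇ x) ∧ edge H x₀ x y)
      common y with free y in fy | y ≟ x₀ | y ≟ x
      ... | false | _        | _       = z≤n
      ... | true  | yes _    | _       = ind≤1 _
      ... | true  | no _     | yes _   = ≤-trans (≤-reflexive (+-identityʳ _)) (ind≤1 _)
      ... | true  | no y≢x₀ | no y≢x with edge H x₀ y w in x₀yw | edge H x y w in xyw
      ...   | false | _     = ≤-trans (ind≤1 _) (s≤s z≤n)
      ...   | true  | false = s≤s z≤n
      ...   | true  | true  = subst (λ b → 2 ≤ 1 + ind b) (sym x₀xy) ≤-refl
        where
        x₀xy : edge H x₀ x y ≡ true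
        x₀xy = fourth-edge H K4⁻-free (≢-sym x≢x₀) (≢-sym y≢x₀) (free≢covered fx₀ cw) (≢-sym y≢x)
                 (free≢covered fx cw) (free≢covered fy cw) x₀xw x₀yw xyw

    linkDeg≤#free : ∀ w x → linkDeg w x ≤ #free
    linkDeg≤#free w x = ∑-mono-≤ (allFin n) (λ y → ind-∧-≤ˡ (free y) _)

    linkSum≤ : ∀ w → linkSum w ≤ 4 * #free + count (rich w) * #free
    linkSum≤ w = begin
      linkSum w                                                         ≤⟨ ∑-mono-≤ (allFin n) split ⟩
      ∑ (allFin n) (λ x → 4 * ind (free x) + ind (rich w x) * #free)    ≡⟨ ∑-distrib-+ (allFin n) _ _ ⟩
      ∑ (allFin n) (λ x → 4 * ind (free x)) + ∑ (allFin n) (λ x → ind (rich w x) * #free)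
        ≡⟨ cong₂ _+_ (∑-distribˡ-* (allFin n) 4 _) (∑-distribʳ-* (allFin n) #free _) ⟩
      4 * #free + count (rich w) * #free                                ∎
      where
      open ≤-Reasoning
      split : ∀ x → ind (free x) * linkDeg w x ≤ 4 * ind (free x) + ind (rich w x) * #free
      split x with free x
      ... | false = z≤n
      ... | true with 5 ≤? linkDeg w x
      ...   | yes _  = ≤-trans (≤-reflexive (*-identityˡ _))
                         (≤-trans (linkDeg≤#free w x) (≤-trans (≤-reflexive (sym (*-identityˡ #free))) (m≤n+m _ 4)))
      ...   | no 5≰ = ≤-trans (≤-reflexive (*-identityˡ _)) (≤-trans (≤-pred (≰⇒> 5≰)) (m≤m+n 4 _))

    linkSum-bound-at-free-max : InducedK4⁻Free H → NoFreeY → ∀ {w} → covered w ≡ true → ∀ {x₀} → free x₀ ≡ true →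
                                (∀ {x} → free x ≡ true → linkDeg w x ≤ linkDeg w x₀) →
                                8 * linkSum w ≤ (2 * #free + 1) * (2 * #free + 1)
    linkSum-bound-at-free-max K4⁻-free noY {w} cw {x₀} fx₀ max = begin
      8 * linkSum w                          ≤⟨ *-monoʳ-≤ 8 (∑-mono-≤ (allFin n) split) ⟩
      8 * ∑ (allFin n) (λ x → ind (link w x₀ x) * (r + 1) + ind (free x ∧ not (link w x₀ x)) * Δ)
          ≡⟨ cong (8 *_) (trans (∑-distrib-+ (allFin n) _ _)
                                (cong₂ _+_ (∑-distribʳ-* (allFin n) (r + 1) _) (∑-distribʳ-* (allFin n) Δ _))) ⟩
      8 * (Δ * (r + 1) + r * Δ)              ≡⟨ cong (8 *_) (collect Δ r) ⟩
      8 * (Δ * (2 * r + 1))                  ≤⟨ 8m[2r+1]≤[2[m+r]+1]² Δ r ⟩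
      (2 * (Δ + r) + 1) * (2 * (Δ + r) + 1)  ≡⟨ cong (λ k → (2 * k + 1) * (2 * k + 1)) Δ+r≡#free ⟩
      (2 * #free + 1) * (2 * #free + 1)      ∎
      where
      open ≤-Reasoning
      Δ r : ℕ
      Δ = linkDeg w x₀
      r = count (λ x → free x ∧ not (link w x₀ x))
      collect : ∀ Δ r → Δ * (r + 1) + r * Δ ≡ Δ * (2 * r + 1)
      collect = solve-∀
      Δ+r≡#free : Δ + r ≡ #free
      Δ+r≡#free = sym (trans (∑-cong (allFin n) split-free) (∑-distrib-+ (allFin n) _ _))
        where
        split-free : ∀ x → ind (free x) ≡ ind (link w x₀ x) + ind (free x ∧ not (link w x₀ x))
        split-free x with free x
        ... | true  = ind-split true ((x ≠ᵇ x₀) ∧ edge H x₀ x w)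
        ... | false = refl
      split : ∀ x → ind (free x) * linkDeg w x ≤ ind (link w x₀ x) * (r + 1) + ind (free x ∧ not (link w x₀ x)) * Δ
      split x with free x in fx
      ... | false = z≤n
      ... | true with x ≟ x₀
      ...   | yes _ = ≤-trans (≤-reflexive (*-identityˡ _)) (≤-trans (max fx) (≤-reflexive (sym (*-identityˡ Δ))))
      ...   | no x≢x₀ with edge H x₀ x w in x₀xw
      ...     | false = ≤-trans (≤-reflexive (*-identityˡ _)) (≤-trans (max fx) (≤-reflexive (sym (*-identityˡ Δ))))
      ...     | true  = ≤-trans (≤-reflexive (*-identityˡ _))
                          (≤-trans neighbour-bound (≤-reflexive (sym (trans (+-identityʳ _) (*-identityˡ _)))))
        where
        neighbour-bound : linkDeg w x ≤ r + 1
        neighbour-bound = +-cancelˡ-≤ Δ _ _ (begin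
          Δ + linkDeg w x ≤⟨ linkDeg-adjacent K4⁻-free noY cw fx₀ fx x≢x₀ x₀xw ⟩
          #free + 1       ≡⟨ cong (_+ 1) (sym Δ+r≡#free) ⟩
          Δ + r + 1       ≡⟨ +-assoc Δ r 1 ⟩
          Δ + (r + 1)     ∎)

    linkSum-bound : InducedK4⁻Free H → NoFreeY → ∀ {w} → covered w ≡ true →
                    8 * linkSum w ≤ (2 * #free + 1) * (2 * #free + 1)
    linkSum-bound K4⁻-free noY {w} cw = at-max (argmax weighted w (allFin n))
                                          (λ x → All.lookup (f[xs]≤f[argmax] w (allFin n)) (∈-tabulate⁺ x))
      where
      weighted : Fin n → ℕ
      weighted x = ind (free x) * linkDeg w x
      at-max : ∀ x₀ → (∀ x → weighted x ≤ weighted x₀) → 8 * linkSum w ≤ (2 * #free + 1) * (2 * #free + 1)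
      at-max x₀ max = by-freeness (free x₀) refl
        where
        by-freeness : ∀ b → free x₀ ≡ b → 8 * linkSum w ≤ (2 * #free + 1) * (2 * #free + 1)
        by-freeness true  fx₀ = linkSum-bound-at-free-max K4⁻-free noY cw fx₀
                                  (λ {x} fx → subst₂ _≤_ (ind-true-* fx) (ind-true-* fx₀) (max x))
        by-freeness false fx₀ = ≤-trans (*-monoʳ-≤ 8 (begin
          linkSum w                  ≤⟨ ∑-mono-≤ (allFin n) (λ x → ≤-trans (max x) (≤-reflexive (ind-false-* fx₀))) ⟩
          ∑ (allFin n) (λ _ → 0)     ≡⟨ trans (∑-const (allFin n) 0) (*-zeroʳ (length (allFin n))) ⟩
          0                          ∎)) z≤n
          where open ≤-Reasoning

    freePair : Fin n → Fin n → ℕ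
    freePair x y = ind (free x) * ind (free y ∧ (y ≠ᵇ x))

    #freePairs freeCodegSum coveredLinkSum : ℕ
    #freePairs     = ∑ (allFin n) (λ x → ∑ (allFin n) (freePair x))
    freeCodegSum   = ∑ (allFin n) (λ x → ∑ (allFin n) (λ y → freePair x y * codeg H x y))
    coveredLinkSum = ∑ (allFin n) (λ z → ind (covered z) * linkSum z)

    #freePairs+#free≡#free² : #freePairs + #free ≡ #free * #free
    #freePairs+#free≡#free² = begin
      #freePairs + #free
        ≡⟨ cong (_+ #free) (∑-cong (allFin n) (λ x → ∑-distribˡ-* (allFin n) (ind (free x)) _)) ⟩
      ∑ (allFin n) (λ x → ind (free x) * others x) + #free ≡⟨ sym (∑-distrib-+ (allFin n) _ _) ⟩
      ∑ (allFin n) (λ x → ind (free x) * others x + ind (free x)) ≡⟨ ∑-cong (allFin n) with-self ⟩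
      ∑ (allFin n) (λ x → ind (free x) * #free)             ≡⟨ ∑-distribʳ-* (allFin n) #free _ ⟩
      #free * #free                                          ∎
      where
      open ≡-Reasoning
      others : Fin n → ℕ
      others x = count (λ y → free y ∧ (y ≠ᵇ x))
      with-self : ∀ x → ind (free x) * others x + ind (free x) ≡ ind (free x) * #free
      with-self x with free x in fx
      ... | false = refl
      ... | true  = begin
        1 * others x + 1                                          ≡⟨ cong (_+ 1) (*-identityˡ (others x)) ⟩
        others x + 1                                              ≡⟨ cong (others x +_) (sym self) ⟩
        others x + count (λ y → free y ∧ not (y ≠ᵇ x))           ≡⟨ sym (∑-distrib-+ (allFin n) _ _) ⟩
        ∑ (allFin n) (λ y → ind (free y ∧ (y ≠ᵇ x)) + ind (free y ∧ not (y ≠ᵇ x)))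
                                                                  ≡⟨ ∑-cong (allFin n) (λ y → sym (ind-split (free y) (y ≠ᵇ x))) ⟩
        #free                                                     ≡⟨ sym (*-identityˡ #free) ⟩
        1 * #free                                                 ∎
        where
        self : count (λ y → free y ∧ not (y ≠ᵇ x)) ≡ 1
        self = trans (∑-cong (allFin n) only-x) (trans (∑-δ x (λ y → ind (free y))) (cong ind fx))
          where
          only-x : ∀ y → ind (free y ∧ not (y ≠ᵇ x)) ≡ ind (y ≡ᵇ x) * ind (free y)
          only-x y with y ≟ x | free y
          ... | yes _ | true  = refl
          ... | yes _ | false = refl
          ... | no _  | true  = refl
          ... | no _  | false = refl

    minCodeg⇒ : ∀ c₁ c₂ → (∀ x y → x ≢ y → c₁ ≤ c₂ * codeg H x y) → #freePairs * c₁ ≤ freeCodegSum * c₂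
    minCodeg⇒ c₁ c₂ minCodeg = begin
      #freePairs * c₁
        ≡⟨ sym (trans (∑-cong (allFin n) (λ x → ∑-distribʳ-* (allFin n) c₁ (freePair x))) (∑-distribʳ-* (allFin n) c₁ _)) ⟩
      ∑ (allFin n) (λ x → ∑ (allFin n) (λ y → freePair x y * c₁))
        ≤⟨ ∑-mono-≤ (allFin n) (λ x → ∑-mono-≤ (allFin n) (pairwise x)) ⟩
      ∑ (allFin n) (λ x → ∑ (allFin n) (λ y → freePair x y * codeg H x y * c₂))
        ≡⟨ trans (∑-cong (allFin n) (λ x → ∑-distribʳ-* (allFin n) c₂ _)) (∑-distribʳ-* (allFin n) c₂ _) ⟩
      freeCodegSum * c₂ ∎
      where
      open ≤-Reasoning
      pairwise : ∀ x y → freePair x y * c₁ ≤ freePair x y * codeg H x y * c₂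
      pairwise x y with free x | free y | y ≟ x
      ... | false | _     | _     = z≤n
      ... | true  | false | _     = z≤n
      ... | true  | true  | yes _ = z≤n
      ... | true  | true  | no y≢x =
        subst₂ _≤_ (sym (*-identityˡ c₁)) (trans (*-comm c₂ _) (cong (_* c₂) (sym (*-identityˡ (codeg H x y)))))
               (minCodeg x y (≢-sym y≢x))

    codeg≤1+covered : NoFreeY → ∀ {x y} → free x ≡ true → free y ≡ true → x ≢ y →
                      codeg H x y ≤ 1 + ∑ (allFin n) (λ z → ind (covered z) * ind (edge H x y z))
    codeg≤1+covered noY {x} {y} fx fy x≢y = begin
      codeg H x y ≤⟨ ∑-mono-≤ (allFin n) split ⟩
      ∑ (allFin n) (λ z → ind (free z ∧ (z ≠ᵇ x) ∧ (z ≠ᵇ y) ∧ edge H x y z) + ind (covered z) * ind (edge H x y z))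
                  ≡⟨ ∑-distrib-+ (allFin n) _ _ ⟩
      freeCodeg x y + ∑ (allFin n) (λ z → ind (covered z) * ind (edge H x y z))
                  ≤⟨ +-monoˡ-≤ _ (noY fx fy x≢y) ⟩
      1 + ∑ (allFin n) (λ z → ind (covered z) * ind (edge H x y z)) ∎
      where
      open ≤-Reasoning
      split : ∀ z → ind ((z ≠ᵇ x) ∧ (z ≠ᵇ y) ∧ edge H x y z)
                    ≤ ind (free z ∧ (z ≠ᵇ x) ∧ (z ≠ᵇ y) ∧ edge H x y z) + ind (covered z) * ind (edge H x y z)
      split z with covered z
      ... | false = m≤m+n _ _
      ... | true  = ≤-trans (ind-∧-≤ʳ (z ≠ᵇ x) _) (≤-trans (ind-∧-≤ʳ (z ≠ᵇ y) _) (≤-reflexive (sym (+-identityʳ _))))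

    freeCodegSum≤ : NoFreeY → freeCodegSum ≤ #freePairs + coveredLinkSum
    freeCodegSum≤ noY = begin
      freeCodegSum                                         ≤⟨ ∑-mono-≤ (allFin n) (λ x → ∑-mono-≤ (allFin n) (pairwise x)) ⟩
      ∑ (allFin n) (λ x → ∑ (allFin n) (λ y → freePair x y + ∑ (allFin n) (F x y)))
        ≡⟨ trans (∑-cong (allFin n) (λ x → ∑-distrib-+ (allFin n) _ _)) (∑-distrib-+ (allFin n) _ _) ⟩
      #freePairs + ∑ (allFin n) (λ x → ∑ (allFin n) (λ y → ∑ (allFin n) (F x y)))
        ≡⟨ cong (#freePairs +_) regroup ⟩
      #freePairs + coveredLinkSum                          ∎
      where
      open ≤-Reasoning
      F : Fin n → Fin n → Fin n → ℕ
      F x y z = ind (covered z) * (ind (free x) * ind (free y ∧ (y ≠ᵇ x) ∧ edge H x y z))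
      pairwise : ∀ x y → freePair x y * codeg H x y ≤ freePair x y + ∑ (allFin n) (F x y)
      pairwise x y with free x in fx | free y in fy | y ≟ x
      ... | false | _     | _     = z≤n
      ... | true  | false | _     = z≤n
      ... | true  | true  | yes _ = z≤n
      ... | true  | true  | no y≢x = begin
        1 * codeg H x y ≡⟨ *-identityˡ _ ⟩
        codeg H x y     ≤⟨ codeg≤1+covered noY fx fy (≢-sym y≢x) ⟩
        1 + ∑ (allFin n) (λ z → ind (covered z) * ind (edge H x y z))
                        ≡⟨ cong (1 +_) (∑-cong (allFin n) (λ z → cong (ind (covered z) *_) (sym (*-identityˡ _)))) ⟩
        1 + ∑ (allFin n) (λ z → ind (covered z) * (1 * ind (edge H x y z))) ∎
      regroup : ∑ (allFin n) (λ x → ∑ (allFin n) (λ y → ∑ (allFin n) (F x y))) ≡ coveredLinkSum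
      regroup = begin-equality
        ∑ (allFin n) (λ x → ∑ (allFin n) (λ y → ∑ (allFin n) (F x y)))
          ≡⟨ ∑-cong (allFin n) (λ x → ∑-comm (allFin n) (allFin n) (F x)) ⟩
        ∑ (allFin n) (λ x → ∑ (allFin n) (λ z → ∑ (allFin n) (λ y → F x y z)))
          ≡⟨ ∑-comm (allFin n) (allFin n) _ ⟩
        ∑ (allFin n) (λ z → ∑ (allFin n) (λ x → ∑ (allFin n) (λ y → F x y z)))
          ≡⟨ ∑-cong (allFin n) factor ⟩
        coveredLinkSum ∎
        where
        factor : ∀ z → ∑ (allFin n) (λ x → ∑ (allFin n) (λ y → F x y z)) ≡ ind (covered z) * linkSum z
        factor z = trans (∑-cong (allFin n) (λ x → trans (∑-distribˡ-* (allFin n) (ind (covered z)) _)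
                                                         (cong (ind (covered z) *_) (∑-distribˡ-* (allFin n) (ind (free x)) _))))
                         (∑-distribˡ-* (allFin n) (ind (covered z)) _)

    module _ (unique : Unique vs) where

      coveredLinkSum≡ : coveredLinkSum ≡ ∑ ts (λ W → ∑ (tileVerts W) linkSum)
      coveredLinkSum≡ = trans (∑-∈? unique linkSum) (∑-concatMap tileVerts ts linkSum)

      #free+4·#tiles≡n : #free + 4 * length ts ≡ n
      #free+4·#tiles≡n = begin
        #free + 4 * length ts        ≡⟨ cong (#free +_) #covered≡ ⟩
        #free + count covered        ≡⟨ sym (∑-distrib-+ (allFin n) _ _) ⟩
        ∑ (allFin n) (λ v → ind (free v) + ind (covered v)) ≡⟨ ∑-cong (allFin n) (λ v → trans (+-comm (ind (free v)) _) (ind-not (covered v))) ⟩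
        ∑ (allFin n) (λ _ → 1)       ≡⟨ trans (∑-const (allFin n) 1) (trans (*-identityʳ _) (length-tabulate (λ i → i))) ⟩
        n                            ∎
        where
        open ≡-Reasoning
        #covered≡ : 4 * length ts ≡ count covered
        #covered≡ = sym (begin
          count covered                            ≡⟨ ∑-cong (allFin n) (λ v → sym (*-identityʳ _)) ⟩
          ∑ (allFin n) (λ v → ind (covered v) * 1) ≡⟨ ∑-∈? unique (λ _ → 1) ⟩
          ∑ vs (λ _ → 1)                           ≡⟨ ∑-concatMap tileVerts ts (λ _ → 1) ⟩
          ∑ ts (λ _ → 4)                           ≡⟨ ∑-const ts 4 ⟩
          length ts * 4                            ≡⟨ *-comm (length ts) 4 ⟩
          4 * length ts                            ∎)

  module Improvement {n} (H : ThreeGraph n) (T : YTiling H) where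
    open Uncovered H (tiles T)
    open DecMembership (_≟_ {n}) using (_∈?_)

    Larger : Set
    Larger = Σ (YTiling H) λ T′ → length (tiles T) < length (tiles T′)

    free⇒∉ : ∀ {v} → free v ≡ true → v ∉ vs
    free⇒∉ {v} fv v∈vs with v ∈? vs
    free⇒∉ ()  v∈vs | yes _
    ... | no v∉vs = v∉vs v∈vs

    ∈⇒covered : ∀ {v} → v ∈ vs → covered v ≡ true
    ∈⇒covered {v} v∈vs with v ∈? vs
    ... | yes _   = refl
    ... | no v∉vs = ⊥-elim (v∉vs v∈vs)

    rich⇒ : ∀ {w x} → rich w x ≡ true → free x ≡ true × 5 ≤ linkDeg w x
    rich⇒ {w} {x} r with free x | 5 ≤? linkDeg w x
    rich⇒ refl | true | yes 5≤ = refl , 5≤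

    rich⇒free : ∀ {w x} → rich w x ≡ true → free x ≡ true
    rich⇒free = proj₁ ∘ rich⇒

    link-free : ∀ {w x y} → link w x y ≡ true → free y ≡ true
    link-free = proj₁ ∘ free-neighbour

    link-≢ : ∀ {w x y} → link w x y ≡ true → y ≢ x
    link-≢ = proj₁ ∘ proj₂ ∘ free-neighbour

    link-edge : ∀ {w x y} → link w x y ≡ true → edge H x w y ≡ true
    link-edge {w} {x} {y} l = trans (sym₂₃ H x w y) (proj₂ (proj₂ (free-neighbour l)))

    rich⇒link-pair : ∀ {w x} → rich w x ≡ true → ∀ S → length S ≤ 3 →
                     ∃₂ λ y z → link w x y ≡ true × link w x z ≡ true × z ≢ y × All (y ≢_) S × All (z ≢_) S
    rich⇒link-pair {w} {x} r S |S|≤3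
      with _ , 5≤deg          ← rich⇒ r
      with y , Ny , y∉S       ← count-witness-∉ (link w x) S (≤-trans (s≤s (m≤n⇒m≤1+n |S|≤3)) 5≤deg)
      with z , Nz , z≢y ∷ z∉S ← count-witness-∉ (link w x) (y ∷ S) (≤-trans (s≤s (s≤s |S|≤3)) 5≤deg)
      = y , z , Ny , Nz , z≢y , y∉S , z∉S

    extend : (Y : Tile n) → IsYCopy H Y → Unique (tileVerts Y) → All (λ v → free v ≡ true) (tileVerts Y) → Larger
    extend Y isY uniqueY allFree =
      record { tiles    = Y ∷ tiles T
             ; copies   = isY ∷ copies T
             ; disjoint = Unique.++⁺ uniqueY (disjoint T) (λ (v∈Y , v∈vs) → free⇒∉ (All.lookup allFree v∈Y) v∈vs) }
      , ≤-refl

    extend-at-freeY : ∀ {x y} → free x ≡ true → free y ≡ true → x ≢ y → 2 ≤ freeCodeg x y → Larger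
    extend-at-freeY {x} {y} fx fy x≢y 2≤codeg
      with z  , Nz  , []          ← count-witness-∉ _ [] (≤-trans (s≤s z≤n) 2≤codeg)
      with z′ , Nz′ , z′≢z ∷ []   ← count-witness-∉ _ (z ∷ []) 2≤codeg
      with fz  , z≢x  , z≢y  , xyz  ← free-common-neighbour Nz
      with fz′ , z′≢x , z′≢y , xyz′ ← free-common-neighbour Nz′
      = extend (x , y , z , z′) (xyz , xyz′)
          ((x≢y ∷ ≢-sym z≢x ∷ ≢-sym z′≢x ∷ []) ∷ (≢-sym z≢y ∷ ≢-sym z′≢y ∷ []) ∷ (≢-sym z′≢z ∷ []) ∷ [] ∷ [])
          (fx ∷ fy ∷ fz ∷ fz′ ∷ [])

    TileBound : Tile n → Set
    TileBound W = 8 * ∑ (tileVerts W) linkSum ≤ (2 * #free + 1) * (2 * #free + 1) + 160 * #free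

    module Replace {W : Tile n} (W∈ts : W ∈ tiles T) where
      pre post rest : List (Tile n)
      pre  = proj₁ (∈-∃++ W∈ts)
      post = proj₁ (proj₂ (∈-∃++ W∈ts))
      rest = pre ++ post

      ts≡ : tiles T ≡ pre ++ W ∷ post
      ts≡ = proj₂ (proj₂ (∈-∃++ W∈ts))

      rv : List (Fin n)
      rv = tilingVerts rest

      mult-split : ∀ v → mult v vs ≡ mult v (tileVerts W) + mult v rv
      mult-split v = begin
        mult v vs                                     ≡⟨ ∑-concatMap tileVerts (tiles T) f ⟩
        ∑ (tiles T) F                                 ≡⟨ cong (λ ts → ∑ ts F) ts≡ ⟩
        ∑ (pre ++ W ∷ post) F                         ≡⟨ ∑-++ pre (W ∷ post) F ⟩
        ∑ pre F + (F W + ∑ post F)                    ≡⟨ move-W (∑ pre F) (F W) (∑ post F) ⟩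
        F W + (∑ pre F + ∑ post F)                    ≡⟨ cong (F W +_) (sym (∑-++ pre post F)) ⟩
        F W + ∑ rest F                                ≡⟨ cong (F W +_) (sym (∑-concatMap tileVerts rest f)) ⟩
        mult v (tileVerts W) + mult v rv              ∎
        where
        open ≡-Reasoning
        f : Fin n → ℕ
        f x = ind (v ≡ᵇ x)
        F : Tile n → ℕ
        F t = ∑ (tileVerts t) f
        move-W : ∀ p w q → p + (w + q) ≡ w + (p + q)
        move-W = solve-∀

      unique-rest : Unique rv
      unique-rest = mult≤1⇒Unique rv (λ v → ≤-trans (m≤n+m _ _) (subst (_≤ 1) (mult-split v) (Unique⇒mult≤1 (disjoint T) v)))

      unique-W : Unique (tileVerts W)
      unique-W = mult≤1⇒Unique (tileVerts W) (λ v → ≤-trans (m≤m+n _ _) (subst (_≤ 1) (mult-split v) (Unique⇒mult≤1 (disjoint T) v)))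

      W⇒covered : ∀ {v} → v ∈ tileVerts W → covered v ≡ true
      W⇒covered {v} v∈W = ∈⇒covered (1≤mult⇒∈ vs (subst (1 ≤_) (sym (mult-split v)) (≤-trans (∈⇒1≤mult v∈W) (m≤m+n _ _))))

      W⇒∉rest : ∀ {v} → v ∈ tileVerts W → v ∉ rv
      W⇒∉rest {v} v∈W v∈rv = 1+n≰n (begin
        2                                    ≤⟨ +-mono-≤ (∈⇒1≤mult v∈W) (∈⇒1≤mult v∈rv) ⟩
        mult v (tileVerts W) + mult v rv     ≡⟨ sym (mult-split v) ⟩
        mult v vs                            ≤⟨ Unique⇒mult≤1 (disjoint T) v ⟩
        1                                    ∎)
        where open ≤-Reasoning

      free⇒∉rest : ∀ {v} → free v ≡ true → v ∉ rv
      free⇒∉rest {v} fv v∈rv = free⇒∉ fv (1≤mult⇒∈ vs (subst (1 ≤_) (sym (mult-split v)) (≤-trans (∈⇒1≤mult v∈rv) (m≤n+m _ _))))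

      rest-copies : All (IsYCopy H) rest
      rest-copies with copies-pre , _ ∷ copies-post ← ++⁻ pre (subst (All (IsYCopy H)) ts≡ (copies T)) =
        ++⁺ copies-pre copies-post

      replace : (Y₁ Y₂ : Tile n) → IsYCopy H Y₁ → IsYCopy H Y₂ → Unique (tileVerts Y₁ ++ tileVerts Y₂) →
                All (λ v → v ∈ tileVerts W ⊎ free v ≡ true) (tileVerts Y₁ ++ tileVerts Y₂) → Larger
      replace Y₁ Y₂ isY₁ isY₂ unique₁₂ sources =
        record { tiles    = Y₁ ∷ Y₂ ∷ rest
               ; copies   = isY₁ ∷ isY₂ ∷ rest-copies
               ; disjoint = subst Unique (++-assoc (tileVerts Y₁) (tileVerts Y₂) rv)
                                  (Unique.++⁺ unique₁₂ unique-rest (λ (v∈Y , v∈rv) → outside-rest (All.lookup sources v∈Y) v∈rv)) }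
        , ≤-reflexive (cong suc (trans (cong length ts≡) (length-++-sucʳ pre W post)))
        where
        outside-rest : ∀ {v} → v ∈ tileVerts W ⊎ free v ≡ true → v ∉ rv
        outside-rest (inj₁ v∈W) = W⇒∉rest v∈W
        outside-rest (inj₂ fv)  = free⇒∉rest fv

      split-rich : ∀ {w w′ x x′} → w ∈ tileVerts W → w′ ∈ tileVerts W → w ≢ w′ →
                   rich w x ≡ true → rich w′ x′ ≡ true → x ≢ x′ → Larger
      split-rich {w} {w′} {x} {x′} w∈W w′∈W w≢w′ rich-wx rich-w′x′ x≢x′ =
        case rich⇒link-pair rich-wx (x′ ∷ []) (s≤s z≤n) of λ where
          (y , z , Ny , Nz , z≢y , y≢x′ ∷ [] , z≢x′ ∷ []) →
            case rich⇒link-pair rich-w′x′ (x ∷ y ∷ z ∷ []) ≤-refl of λ where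
              (y′ , z′ , Ny′ , Nz′ , z′≢y′ , y′≢x ∷ y′≢y ∷ y′≢z ∷ [] , z′≢x ∷ z′≢y ∷ z′≢z ∷ []) →
                let x∉W  = outside-W (rich⇒free rich-wx)
                    x′∉W = outside-W (rich⇒free rich-w′x′)
                    y∉W  = outside-W (link-free Ny)
                    z∉W  = outside-W (link-free Nz)
                    y′∉W = outside-W (link-free Ny′)
                    z′∉W = outside-W (link-free Nz′)
                in replace (x , w , y , z) (x′ , w′ , y′ , z′) (link-edge Ny , link-edge Nz) (link-edge Ny′ , link-edge Nz′)
                     ( (x∉W w∈W ∷ ≢-sym (link-≢ Ny) ∷ ≢-sym (link-≢ Nz) ∷ x≢x′ ∷ x∉W w′∈W ∷ ≢-sym y′≢x ∷ ≢-sym z′≢x ∷ [])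
                     ∷ (≢-sym (y∉W w∈W) ∷ ≢-sym (z∉W w∈W) ∷ ≢-sym (x′∉W w∈W) ∷ w≢w′ ∷ ≢-sym (y′∉W w∈W) ∷ ≢-sym (z′∉W w∈W) ∷ [])
                     ∷ (≢-sym z≢y ∷ y≢x′ ∷ y∉W w′∈W ∷ ≢-sym y′≢y ∷ ≢-sym z′≢y ∷ [])
                     ∷ (z≢x′ ∷ z∉W w′∈W ∷ ≢-sym y′≢z ∷ ≢-sym z′≢z ∷ [])
                     ∷ (x′∉W w′∈W ∷ ≢-sym (link-≢ Ny′) ∷ ≢-sym (link-≢ Nz′) ∷ [])
                     ∷ (≢-sym (y′∉W w′∈W) ∷ ≢-sym (z′∉W w′∈W) ∷ [])
                     ∷ (≢-sym z′≢y′ ∷ [])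
                     ∷ [] ∷ [])
                     (inj₂ (rich⇒free rich-wx) ∷ inj₁ w∈W ∷ inj₂ (link-free Ny) ∷ inj₂ (link-free Nz)
                      ∷ inj₂ (rich⇒free rich-w′x′) ∷ inj₁ w′∈W ∷ inj₂ (link-free Ny′) ∷ inj₂ (link-free Nz′) ∷ [])
        where
        outside-W : ∀ {v} → free v ≡ true → ∀ {u} → u ∈ tileVerts W → v ≢ u
        outside-W fv u∈W = free≢covered fv (W⇒covered u∈W)

      corner : Fin (length (tileVerts W)) → Fin n
      corner = lookup (tileVerts W)

      tile-step : InducedK4⁻Free H → NoFreeY → Larger ⊎ TileBound W
      tile-step K4⁻-free noY =
        case two-rich-or-∑-bounded (linkSum ∘ corner) (count ∘ rich ∘ corner) ((2 * #free + 1) * (2 * #free + 1)) #free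
               (λ i → linkSum-bound K4⁻-free noY (W⇒covered (∈-lookup i))) (λ i → linkSum≤ (corner i)) of λ where
          (inj₂ bounded) →
            inj₂ (subst (λ s → 8 * s ≤ (2 * #free + 1) * (2 * #free + 1) + 160 * #free) (∑-lookup (tileVerts W) linkSum) bounded)
          (inj₁ (i , j , i≢j , 2≤#richᵢ , 1≤#richⱼ)) → case count-witness-∉ (rich (corner j)) [] 1≤#richⱼ of λ where
            (x′ , rich-x′ , []) → case count-witness-∉ (rich (corner i)) (x′ ∷ []) 2≤#richᵢ of λ where
              (x , rich-x , x≢x′ ∷ []) →
                inj₁ (split-rich (∈-lookup i) (∈-lookup j) (i≢j ∘ lookup-injective unique-W) rich-x rich-x′ x≢x′)

    improve-or-stuck : InducedK4⁻Free H → Larger ⊎ (NoFreeY × All TileBound (tiles T))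
    improve-or-stuck K4⁻-free = decide (any? (λ x → any? (λ y → freeY? x y)))
      where
      FreeY : Fin n → Fin n → Set
      FreeY x y = free x ≡ true × free y ≡ true × x ≢ y × 2 ≤ freeCodeg x y
      freeY? : ∀ x y → Dec (FreeY x y)
      freeY? x y = (free x Bool.≟ true) ×-dec (free y Bool.≟ true) ×-dec ¬? (x ≟ y) ×-dec (2 ≤? freeCodeg x y)
      stuck-if-all-bounded : NoFreeY → Larger ⊎ All TileBound (tiles T) → Larger ⊎ (NoFreeY × All TileBound (tiles T))
      stuck-if-all-bounded noY (inj₁ larger) = inj₁ larger
      stuck-if-all-bounded noY (inj₂ bounds) = inj₂ (noY , bounds)
      decide : Dec (∃₂ FreeY) → Larger ⊎ (NoFreeY × All TileBound (tiles T))
      decide (yes (x , y , fx , fy , x≢y , 2≤codeg)) = inj₁ (extend-at-freeY fx fy x≢y 2≤codeg)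
      decide (no no-freeY) =
        stuck-if-all-bounded noY (some-or-All (tiles T) (λ W∈ts → Replace.tile-step W∈ts K4⁻-free noY))
        where
        noY : NoFreeY
        noY {x} {y} fx fy x≢y = ≤-pred (≰⇒> (λ 2≤codeg → no-freeY (x , y , fx , fy , x≢y , 2≤codeg)))

  module _ {n} (H : ThreeGraph n) where

    #tiles≤n : (T : YTiling H) → length (tiles T) ≤ n
    #tiles≤n T = begin
      length (tiles T)             ≤⟨ m≤n*m (length (tiles T)) 4 ⟩
      4 * length (tiles T)         ≤⟨ m≤n+m _ #free ⟩
      #free + 4 * length (tiles T) ≡⟨ #free+4·#tiles≡n (disjoint T) ⟩
      n                            ∎
      where
      open ≤-Reasoning
      open Uncovered H (tiles T)

    stuck⇒few-uncovered : (T : YTiling H) → ∀ a b → 1 ≤ a → 1 ≤ b → 2 * b ≤ n →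
                          (∀ x y → x ≢ y → (b + 8 * a) * n ≤ 8 * b * codeg H x y) →
                          Uncovered.NoFreeY H (tiles T) → All (Improvement.TileBound H T) (tiles T) →
                          a * uncovered T ≤ 40 * b + a
    stuck⇒few-uncovered T a b 1≤a 1≤b 2b≤n degree noY bounds =
      quadratic⇒linear a b #free #freePairs #freePairs+#free≡#free²
        (codegreeCount⇒quadratic a b n #free (length (tiles T)) #freePairs freeCodegSum coveredLinkSum
           1≤a 1≤b 2b≤n (#free+4·#tiles≡n (disjoint T)) #freePairs+#free≡#free²
           (minCodeg⇒ ((b + 8 * a) * n) (8 * b) degree) (freeCodegSum≤ noY) 8S≤tK)
      where
      open Uncovered H (tiles T)
      8S≤tK : 8 * coveredLinkSum ≤ length (tiles T) * ((2 * #free + 1) * (2 * #free + 1) + 160 * #free)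
      8S≤tK = subst (λ s → 8 * s ≤ length (tiles T) * ((2 * #free + 1) * (2 * #free + 1) + 160 * #free))
                    (sym (coveredLinkSum≡ (disjoint T)))
                    (*-∑-≤ (tiles T) (λ W → ∑ (tileVerts W) linkSum) 8 _ bounds)

    almost-perfect-Y-tiling : InducedK4⁻Free H → ∀ a b → 1 ≤ a → 1 ≤ b → 2 * b ≤ n →
                              (∀ x y → x ≢ y → (b + 8 * a) * n ≤ 8 * b * codeg H x y) →
                              Σ (YTiling H) λ T → a * uncovered T ≤ 40 * b + a
    almost-perfect-Y-tiling K4⁻-free a b 1≤a 1≤b 2b≤n degree =
      let T , noY , bounds = reach-stuck (length ∘ tiles) n #tiles≤n
                               (λ T → Improvement.improve-or-stuck H T K4⁻-free) empty
      in T , stuck⇒few-uncovered T a b 1≤a 1≤b 2b≤n degree noY bounds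
      where
      empty : YTiling H
      empty = record { tiles = [] ; copies = [] ; disjoint = [] }

module Rationals where
  open import Data.Nat using (ℕ; suc; _+_; _*_; _≤_)
  open import Data.Nat.Coprimality using (Coprime; 1-coprimeTo) renaming (sym to coprime-sym)
  open import Data.Integer using (+_; +[1+_]; +≤+)
  import Data.Integer as ℤ
  open import Data.Integer.Properties using (+◃n≡+n; drop‿+≤+; pos-+; pos-*)
  import Data.Sign as Sign
  open import Data.Rational using (ℚ; mkℚ; _/_; toℚᵘ)
  import Data.Rational as ℚ
  import Data.Rational.Properties as ℚ
  open import Data.Rational.Unnormalised using (mkℚᵘ; *≤*)
  import Data.Rational.Unnormalised as ℚᵘ
  import Data.Rational.Unnormalised.Properties as ℚᵘ
  open import Relation.Binary.PropositionalEquality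
  open import Data.Nat.Tactic.RingSolver using (solve-∀)

  toℚᵘ-n/1 : ∀ n → toℚᵘ (+ n / 1) ≡ mkℚᵘ (+ n) 0
  toℚᵘ-n/1 n = cong toℚᵘ (ℚ.normalize-coprime {n} {0} (coprime-sym (1-coprimeTo n)))

  ℤ⇒ℕ-≤ : ∀ X B C → (Sign.+ ℤ.◃ X) ℤ.* + 1 ℤ.≤ + B ℤ.* + C → X * 1 ≤ B * C
  ℤ⇒ℕ-≤ X B C p rewrite +◃n≡+n X | sym (pos-* X 1) | sym (pos-* B C) = drop‿+≤+ p

  -- The integer inequalities below are ℚᵘ's cross products ↥p·↧q ≤ ↥q·↧p, written in the
  -- unreduced shape in which they compute.
  module _ (a-1 b-1 : ℕ) .(c : Coprime (suc a-1) (suc b-1)) where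
    private
      γ : ℚ
      γ = mkℚ +[1+ a-1 ] b-1 c

    minCodeg⇒ℕ : ∀ n k → (+ 1 / 8 ℚ.+ γ) ℚ.* (+ n / 1) ℚ.≤ + k / 1 → (suc b-1 + 8 * suc a-1) * n ≤ 8 * suc b-1 * k
    minCodeg⇒ℕ n k δ≤k =
      subst₂ _≤_ (lhs (suc a-1) (suc b-1) n) (rhs (suc b-1) k) (ℤ⇒ℕ-≤ ((1 * suc b-1 + suc a-1 * 8) * n) k (8 * suc b-1 * 1) (ℚᵘ.drop-*≤* unnormalised))
      where
      homo : toℚᵘ ((+ 1 / 8 ℚ.+ γ) ℚ.* (+ n / 1)) ℚᵘ.≃ (mkℚᵘ (+ 1) 7 ℚᵘ.+ mkℚᵘ +[1+ a-1 ] b-1) ℚᵘ.* mkℚᵘ (+ n) 0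
      homo = ℚᵘ.≃-trans (ℚ.toℚᵘ-homo-* (+ 1 / 8 ℚ.+ γ) (+ n / 1))
               (ℚᵘ.≃-trans (ℚᵘ.*-congʳ (ℚ.toℚᵘ-homo-+ (+ 1 / 8) γ))
                 (subst (λ q → (toℚᵘ (+ 1 / 8) ℚᵘ.+ toℚᵘ γ) ℚᵘ.* toℚᵘ (+ n / 1) ℚᵘ.≃ (mkℚᵘ (+ 1) 7 ℚᵘ.+ mkℚᵘ +[1+ a-1 ] b-1) ℚᵘ.* q)
                        (toℚᵘ-n/1 n) ℚᵘ.≃-refl))
      unnormalised : (mkℚᵘ (+ 1) 7 ℚᵘ.+ mkℚᵘ +[1+ a-1 ] b-1) ℚᵘ.* mkℚᵘ (+ n) 0 ℚᵘ.≤ mkℚᵘ (+ k) 0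
      unnormalised = subst (_ ℚᵘ.≤_) (toℚᵘ-n/1 k) (ℚᵘ.≤-respˡ-≃ homo (ℚ.toℚᵘ-mono-≤ δ≤k))
      lhs : ∀ a b n → (1 * b + a * 8) * n * 1 ≡ (b + 8 * a) * n
      lhs = solve-∀
      rhs : ∀ b k → k * (8 * b * 1) ≡ 8 * b * k
      rhs = solve-∀

    ℕ⇒≤bound : ∀ u → suc a-1 * u ≤ 40 * suc b-1 + suc a-1 → + u / 1 ℚ.≤ bound γ
    ℕ⇒≤bound u au≤ =
      ℚ.toℚᵘ-cancel-≤ (ℚᵘ.≤-respʳ-≃ (ℚᵘ.≃-sym homo) (subst (ℚᵘ._≤ _) (sym (toℚᵘ-n/1 u)) (*≤* cross)))
      where
      a = suc a-1
      b = suc b-1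
      homo : toℚᵘ (bound γ) ℚᵘ.≃ (mkℚᵘ (+ 40) 0 ℚᵘ.* mkℚᵘ +[1+ b-1 ] a-1) ℚᵘ.+ mkℚᵘ (+ 1) 0
      homo = ℚᵘ.≃-trans (ℚ.toℚᵘ-homo-+ ((+ 40 / 1) ℚ.÷ γ) (+ 1 / 1))
               (ℚᵘ.+-congˡ (toℚᵘ (+ 1 / 1)) (ℚ.toℚᵘ-homo-* (+ 40 / 1) (ℚ.1/ γ)))
      cross : + u ℤ.* + (1 * a * 1) ℤ.≤ (+ 40 ℤ.* + b ℤ.* + 1 ℤ.+ + 1 ℤ.* + (1 * a)) ℤ.* + 1
      cross = subst₂ ℤ._≤_ (pos-* u (1 * a * 1)) ↥q-form (+≤+ (subst₂ _≤_ (lhs a u) (rhs a b) au≤))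
        where
        ↥q-form : + ((40 * b * 1 + 1 * (1 * a)) * 1) ≡ (+ 40 ℤ.* + b ℤ.* + 1 ℤ.+ + 1 ℤ.* + (1 * a)) ℤ.* + 1
        ↥q-form = trans (pos-* (40 * b * 1 + 1 * (1 * a)) 1)
                        (cong (ℤ._* + 1) (trans (pos-+ (40 * b * 1) (1 * (1 * a)))
                                                (cong₂ ℤ._+_ (trans (pos-* (40 * b) 1) (cong (ℤ._* + 1) (pos-* 40 b)))
                                                             (pos-* 1 (1 * a)))))
        lhs : ∀ a u → a * u ≡ u * (1 * a * 1)
        lhs = solve-∀
        rhs : ∀ a b → 40 * b + a ≡ (40 * b * 1 + 1 * (1 * a)) * 1
        rhs = solve-∀

open Tiling using (almost-perfect-Y-tiling)
open Rationals using (minCodeg⇒ℕ; ℕ⇒≤bound)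
import Data.Nat as ℕ
open import Data.Product using (_,_)
open import Data.Integer using (+[1+_])
open import Data.Rational using (mkℚ)

open import Data.Nat using (ℕ; _≥_)
open import Data.Product using (Σ; ∃)
open import Data.Integer using (+_)
open import Data.Rational using (ℚ; _/_; _+_; _*_; _≤_; Positive)

theorem3p3 : (γ : ℚ) → .{{_ : Positive γ}} →
    ∃ λ (n₀ : ℕ) → ∀ (n : ℕ) → n ≥ n₀ →
    (H : ThreeGraph n) → InducedK4⁻Free H →
    MinCodegAtLeast H ((+ 1 / 8 + γ) * (+ n / 1)) →
    Σ (YTiling H) λ T → (+ uncovered T / 1) ≤ bound γ
theorem3p3 (mkℚ +[1+ a-1 ] b-1 c) = 2 ℕ.* b , λ n 2b≤n H K4⁻-free δ₂≥ →
  let T , a·u≤40b+a = almost-perfect-Y-tiling H K4⁻-free a b (ℕ.s≤s ℕ.z≤n) (ℕ.s≤s ℕ.z≤n) 2b≤n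
                        (λ x y x≢y → minCodeg⇒ℕ a-1 b-1 c n (codeg H x y) (δ₂≥ x y x≢y))
  in T , ℕ⇒≤bound a-1 b-1 c (uncovered T) a·u≤40b+a
  where
  a b : ℕ
  a = ℕ.suc a-1
  b = ℕ.suc b-1
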